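{- Let $a<b$ be positive integers and let $\lambda$ be a partition such that $\lambda^{\mathrm{Cr}_{a,b}}$ is a partition and $\lambda$ contains no box $(i,j)$ with $H_{i,j}=tb$ and $l_{i,j}=ta$ for some positive integer $t$. Then for every $y\in[1,\lambda_1]$ with $\ell_{1,y}\not\subseteq\lambda$, the northernmost box $(i,j)$ (i.e. with smallest $i$) of $\ell_{1,y}\setminus\lambda$ satisfies $(i-1,j)\in\lambda$.
   Context: Partitions are identified with Young diagrams $\{(i,j)\in\mathbb{Z}_{>0}^2: j\le\lambda_i\}$ (row $i$, column $j$). Arm $a_{i,j}=\lambda_i-j$, leg $l_{i,j}=\lambda^{\mathrm{Tr}}_j-i$, hook length $H_{i,j}=1+a_{i,j}+l_{i,j}$. For $(x,y)\in\mathbb{Z}^2$, the ladder $\ell_{x,y}=\{(i,j)\in\mathbb{Z}_{>0}^2:\exists t\in\mathbb{Z},\ i=x-ta,\ j=y+t(b-a)\}$. $\lambda^{\mathrm{Cr}_{a,b}}$ is obtained by replacing, for each ladder $\ell$, $\lambda\cap\ell$ by the $|\lambda\cap\ell|$ points of $\ell$ with the largest first coordinates. -}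

module Defs where

open import Data.Nat using (ℕ; zero; suc; _+_; _*_; _∸_; _≤_; _<_; _≤?_)
open import Data.Product using (Σ; _×_; _,_; proj₁; proj₂; ∃₂)
open import Data.List using (List; []; _∷_; length; filter)
open import Data.List.Relation.Unary.All using (All)
open import Data.List.Relation.Unary.Linked using (Linked)
open import Data.List.Relation.Unary.Unique.Propositional using (Unique)
open import Data.List.Membership.Propositional using (_∈_)
open import Function.Bundles using (_⇔_)
open import Relation.Binary.PropositionalEquality using (_≡_)
open import Data.Nat using (_≥_)
import Data.Integer as Z

record Partition : Set where
  field
    parts    : List ℕ
    decr     : Linked _≥_ parts
    positive : All (λ k → 1 ≤ k) parts
open Partition public

Box : Set
Box = ℕ × ℕ

get0 : List ℕ → ℕ → ℕ
get0 []       _       = 0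
get0 (x ∷ xs) zero    = x
get0 (x ∷ xs) (suc n) = get0 xs n

-- λ_i (rows are 1-indexed; λ_i = 0 for i beyond the length)
row : Partition → ℕ → ℕ
row lam i = get0 (parts lam) (i ∸ 1)

col : Partition → ℕ → ℕ
col lam j = length (filter (j ≤?_) (parts lam))

_∈ᵧ_ : Box → Partition → Set
(i , j) ∈ᵧ lam = 1 ≤ i × 1 ≤ j × j ≤ row lam i

arm leg hook : Partition → ℕ → ℕ → ℕ
arm lam i j = row lam i ∸ j
leg lam i j = col lam j ∸ i
hook lam i j = 1 + arm lam i j + leg lam i j

InLadder : (a b x y : ℕ) → Box → Set
InLadder a b x y (i , j) =
  1 ≤ i × 1 ≤ j ×
  Σ Z.ℤ (λ t → (Z.+ i ≡ (Z.+ x) Z.- t Z.* (Z.+ a)) ×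
               (Z.+ j ≡ (Z.+ y) Z.+ t Z.* ((Z.+ b) Z.- (Z.+ a))))

HasCard : (Box → Set) → ℕ → Set
HasCard P n = Σ (List Box) (λ xs → Unique xs × (∀ p → (p ∈ xs) ⇔ P p) × length xs ≡ n)

-- Membership in λ^{Cr_{a,b}}: (p,q) lies on the ladder ℓ_{p,q} and is among the
-- |λ ∩ ℓ_{p,q}| points of ℓ_{p,q} with largest first coordinate, i.e. the number
-- of points of ℓ_{p,q} with first coordinate ≥ p is at most |λ ∩ ℓ_{p,q}|.
InCr : (a b : ℕ) → Partition → Box → Set
InCr a b lam (p , q) =
  1 ≤ p × 1 ≤ q ×
  ∃₂ λ k m → HasCard (λ r → r ∈ᵧ lam × InLadder a b p q r) k
           × HasCard (λ r → InLadder a b p q r × p ≤ proj₁ r) m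
           × m ≤ k

IsPartitionSet : (Box → Set) → Set
IsPartitionSet S =
  (Σ ℕ λ n → HasCard S n) ×
  (∀ i j → S (i , j) → 1 ≤ i × 1 ≤ j) ×
  (∀ i j → S (i , j) → 2 ≤ i → S (i ∸ 1 , j)) ×
  (∀ i j → S (i , j) → 2 ≤ j → S (i , j ∸ 1))

-- Let d = b − a, so that ℓ_{1,y} = {(1 + w a, y − w d) : w ≥ 0}, and suppose that the northernmost
-- gap (1 + s a, j) of ℓ_{1,y} has (s a, j) ∉ λ. Then s ≥ 1, and for g = λ_{sa} the ladder ℓ through
-- (1, g + 1 + s d) consists of the boxes pt 1 w = (1 + w a, g + 1 + (s − w) d) for w ≤ S, the last
-- index with a positive column. Those with w < s lie in λ (they are left of boxes of ℓ_{1,y} north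
-- of the gap) and pt 1 s ∉ λ; pt 0 w is the box just above pt 1 w, on the ladder ℓ′.
-- If pt 0 w ∈ λ but pt 1 w ∉ λ for some w > s, the box of row s a in the column of pt 1 w has leg
-- (w − s) a and hook (w − s) b, which is excluded. So moving one row down maps λ ∩ ℓ′ injectively
-- into λ ∩ ℓ, missing pt 1 0, and |λ ∩ ℓ′| < K = |λ ∩ ℓ|. On the other hand K ≤ S, and pt 1 u
-- with u = S + 1 − K lies in λ^{Cr_{a,b}}, since exactly K boxes of ℓ are at or below it. As
-- λ^{Cr_{a,b}} is a partition, pt 0 u lies in it as well, which forces the K boxes of ℓ′ at or
-- below pt 0 u to number at most |λ ∩ ℓ′|: a contradiction.

module Submission where

open import Defs
open import Data.Product using (Σ; _×_; _,_; proj₁; proj₂)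
open import Function.Bundles using (_⇔_; mk⇔; Equivalence)
open import Relation.Binary.PropositionalEquality

module Ladder where
  open import Data.Nat as ℕ using (ℕ; zero; suc)
  import Data.Nat.Properties as ℕ
  open import Data.Integer hiding (suc)
  open import Data.Integer.Properties using (pos-+; pos-*; +-injective)
  open import Data.Integer.Tactic.RingSolver using (solve-∀)
  open import Data.Empty using (⊥-elim)

  pos-+-* : ∀ x w a → + (x ℕ.+ w ℕ.* a) ≡ + x + + w * + a
  pos-+-* x w a = trans (pos-+ x (w ℕ.* a)) (cong (λ z → + x + z) (pos-* w a))

  ladder-step-nonpos : ∀ {i x a} t → + i ≡ + x - t * + a → 1 ℕ.≤ i → x ℕ.≤ 1 → 1 ℕ.≤ a →
    Σ ℕ λ w → t ≡ - + w
  ladder-step-nonpos (+ zero)  _  _   _   _   = 0 , refl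
  ladder-step-nonpos -[1+ n ]  _  _   _   _   = suc n , refl
  ladder-step-nonpos {i} {x} {a} (+ suc n) eᵢ 1≤i x≤1 1≤a = ⊥-elim (ℕ.<-irrefl refl (begin
    2                 ≤⟨ ℕ.+-mono-≤ 1≤i (ℕ.≤-trans 1≤a (ℕ.m≤m+n a (n ℕ.* a))) ⟩
    i ℕ.+ suc n ℕ.* a ≡⟨ +-injective i+[1+n]a≡x ⟩
    x                 ≤⟨ x≤1 ⟩
    1                 ∎))
    where
    open ℕ.≤-Reasoning
    cancel : ∀ X Y → X - Y + Y ≡ X
    cancel = solve-∀
    i+[1+n]a≡x : + (i ℕ.+ suc n ℕ.* a) ≡ + x
    i+[1+n]a≡x = trans (pos-+-* i (suc n) a)
      (trans (cong (_+ + suc n * + a) eᵢ) (cancel (+ x) (+ suc n * + a)))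

  module _ {a b d : ℕ} (b≡a+d : b ≡ a ℕ.+ d) where

    D : ℤ
    D = + b - + a

    b-a≡d : D ≡ + d
    b-a≡d rewrite b≡a+d = trans (cong (_- + a) (pos-+ a d)) (cancel (+ a) (+ d))
      where
      cancel : ∀ A D → A + D - A ≡ D
      cancel = solve-∀

    pos-+-*d : ∀ c w → + (c ℕ.+ w ℕ.* d) ≡ + c + + w * D
    pos-+-*d c w = trans (pos-+-* c w d) (cong (λ D → + c + + w * D) (sym b-a≡d))

    InLadder-shift : ∀ x w c r →
      InLadder a b (x ℕ.+ w ℕ.* a) c r ⇔ InLadder a b x (c ℕ.+ w ℕ.* d) r
    InLadder-shift x w c (i , j) = mk⇔ to from
      where
      to : InLadder a b (x ℕ.+ w ℕ.* a) c (i , j) → InLadder a b x (c ℕ.+ w ℕ.* d) (i , j)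
      to (1≤i , 1≤j , t , eᵢ , eⱼ) = 1≤i , 1≤j , t - + w ,
        trans eᵢ (trans (cong (_- t * + a) (pos-+-* x w a)) (shiftᵢ (+ x) (+ w) (+ a) t)) ,
        trans eⱼ (trans (shiftⱼ (+ c) (+ w) D t) (cong (_+ (t - + w) * D) (sym (pos-+-*d c w))))
        where
        shiftᵢ : ∀ X W A T → X + W * A - T * A ≡ X - (T - W) * A
        shiftᵢ = solve-∀
        shiftⱼ : ∀ C W D T → C + T * D ≡ C + W * D + (T - W) * D
        shiftⱼ = solve-∀
      from : InLadder a b x (c ℕ.+ w ℕ.* d) (i , j) → InLadder a b (x ℕ.+ w ℕ.* a) c (i , j)
      from (1≤i , 1≤j , t , eᵢ , eⱼ) = 1≤i , 1≤j , t + + w ,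
        trans eᵢ (trans (shiftᵢ (+ x) (+ w) (+ a) t) (cong (_- (t + + w) * + a) (sym (pos-+-* x w a)))) ,
        trans eⱼ (trans (cong (_+ t * D) (pos-+-*d c w)) (shiftⱼ (+ c) (+ w) D t))
        where
        shiftᵢ : ∀ X W A T → X - T * A ≡ X + W * A - (T + W) * A
        shiftᵢ = solve-∀
        shiftⱼ : ∀ C W D T → C + W * D + T * D ≡ C + (T + W) * D
        shiftⱼ = solve-∀

    InLadder⇔ℕ : ∀ {x Y i j} → 1 ℕ.≤ a → x ℕ.≤ 1 → InLadder a b x Y (i , j) ⇔
      (1 ℕ.≤ i × 1 ℕ.≤ j × Σ ℕ λ w → i ≡ x ℕ.+ w ℕ.* a × j ℕ.+ w ℕ.* d ≡ Y)
    InLadder⇔ℕ {x} {Y} {i} {j} 1≤a x≤1 = mk⇔ to from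
      where
      Steps : Set
      Steps = 1 ℕ.≤ i × 1 ℕ.≤ j × Σ ℕ λ w → i ≡ x ℕ.+ w ℕ.* a × j ℕ.+ w ℕ.* d ≡ Y
      to : InLadder a b x Y (i , j) → Steps
      to (1≤i , 1≤j , t , eᵢ , eⱼ) with ladder-step-nonpos t eᵢ 1≤i x≤1 1≤a
      ... | w , refl = 1≤i , 1≤j , w ,
        +-injective (trans eᵢ (trans (unshiftᵢ (+ x) (+ w) (+ a)) (sym (pos-+-* x w a)))) ,
        +-injective (trans (pos-+-*d j w) (trans (cong (_+ + w * D) eⱼ) (unshiftⱼ (+ Y) (+ w) D)))
        where
        unshiftᵢ : ∀ X W A → X - (- W) * A ≡ X + W * A
        unshiftᵢ = solve-∀
        unshiftⱼ : ∀ Y W D → Y + (- W) * D + W * D ≡ Y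
        unshiftⱼ = solve-∀
      from : Steps → InLadder a b x Y (i , j)
      from (1≤i , 1≤j , w , refl , refl) = 1≤i , 1≤j , - + w ,
        trans (pos-+-* x w a) (shiftᵢ (+ x) (+ w) (+ a)) ,
        trans (shiftⱼ (+ j) (+ w) D) (cong (_+ (- + w) * D) (sym (pos-+-*d j w)))
        where
        shiftᵢ : ∀ X W A → X + W * A ≡ X - (- W) * A
        shiftᵢ = solve-∀
        shiftⱼ : ∀ J W D → J ≡ J + W * D + (- W) * D
        shiftⱼ = solve-∀

open Ladder
open Equivalence using (to; from)

open import Data.Nat using (ℕ; zero; suc; _+_; _*_; _∸_; _≤_; _<_; _≥_; _≤?_; z≤n; s≤s; s≤s⁻¹; NonZero; >-nonZero)
open import Data.Nat.Properties
open import Data.Nat.DivMod using (_/_; m/n*n≤m; m*n/n≡m; /-monoˡ-≤)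
open import Data.Empty using (⊥; ⊥-elim)
open import Data.Sum using (inj₁; inj₂)
open import Data.List using (List; []; _∷_; length; filter; map; applyUpTo; upTo; _++_)
open import Data.List.Properties using (length-++; length-map; length-applyUpTo; filter-accept; filter-reject)
import Data.List.Relation.Unary.All as All
open import Data.List.Relation.Unary.Any using (here; there)
open import Data.List.Relation.Unary.Linked as Linked using (Linked; _∷_)
open import Data.List.Relation.Unary.Unique.Propositional using (Unique; _∷_)
open import Data.List.Relation.Unary.Unique.Propositional.Properties using (map⁺; filter⁺; applyUpTo⁺₁; upTo⁺)
open import Data.List.Relation.Binary.Subset.Propositional using (_⊆_)
open import Data.List.Membership.Propositional using (_∈_; _∉_)
open import Data.List.Membership.Propositional.Properties
open import Function.Base using (_∘_)
open import Function.Definitions using (Injective)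
open import Relation.Nullary using (¬_; Dec; yes; no; contradiction)
open import Relation.Nullary.Decidable using (_×-dec_)
open import Relation.Binary.Definitions using (tri<; tri≈; tri>)

module _ {A : Set} where

  Unique-⊆⇒length≤ : {xs ys : List A} → Unique xs → xs ⊆ ys → length xs ≤ length ys
  Unique-⊆⇒length≤ {[]} _ _ = z≤n
  Unique-⊆⇒length≤ {x ∷ xs} (x∉xs ∷ !xs) xs⊆ys with ∈-∃++ (xs⊆ys (here refl))
  ... | ys₁ , ys₂ , refl = begin
    suc (length xs)              ≤⟨ s≤s (Unique-⊆⇒length≤ !xs xs⊆ys₁++ys₂) ⟩
    suc (length (ys₁ ++ ys₂))    ≡⟨ cong suc (length-++ ys₁) ⟩
    suc (length ys₁ + length ys₂) ≡⟨ +-suc (length ys₁) (length ys₂) ⟨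
    length ys₁ + length (x ∷ ys₂) ≡⟨ length-++ ys₁ ⟨
    length (ys₁ ++ x ∷ ys₂)      ∎
    where
    open ≤-Reasoning
    xs⊆ys₁++ys₂ : xs ⊆ ys₁ ++ ys₂
    xs⊆ys₁++ys₂ z∈xs with ∈-++⁻ ys₁ (xs⊆ys (there z∈xs))
    ... | inj₁ z∈ys₁         = ∈-++⁺ˡ z∈ys₁
    ... | inj₂ (here refl)   = contradiction refl (All.lookup x∉xs z∈xs)
    ... | inj₂ (there z∈ys₂) = ∈-++⁺ʳ ys₁ z∈ys₂

  Unique-⊆⇒length< : {xs ys : List A} {y : A} →
    Unique xs → xs ⊆ ys → y ∈ ys → y ∉ xs → length xs < length ys
  Unique-⊆⇒length< {xs} {ys} {y} !xs xs⊆ys y∈ys y∉xs =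
    Unique-⊆⇒length≤ (All.tabulate y≢ ∷ !xs) y∷xs⊆ys
    where
    y≢ : ∀ {z} → z ∈ xs → y ≢ z
    y≢ z∈xs refl = y∉xs z∈xs
    y∷xs⊆ys : y ∷ xs ⊆ ys
    y∷xs⊆ys (here refl) = y∈ys
    y∷xs⊆ys (there z∈xs) = xs⊆ys z∈xs

module _ {P : Box → Set} where

  HasCard-map : ∀ {A : Set} {ws : List A} (f : A → Box) → Injective _≡_ _≡_ f → Unique ws →
    (∀ r → r ∈ map f ws ⇔ P r) → HasCard P (length ws)
  HasCard-map {ws = ws} f f-inj !ws ∈⇔ = map f ws , map⁺ f-inj !ws , ∈⇔ , length-map f ws

  HasCard⇒length≤ : ∀ {n xs} → HasCard P n → Unique xs → (∀ {r} → r ∈ xs → P r) → length xs ≤ n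
  HasCard⇒length≤ (zs , _ , ∈⇔ , refl) !xs xs⊆P = Unique-⊆⇒length≤ !xs (λ r∈xs → ∈⇔ _ .from (xs⊆P r∈xs))

  HasCard⇒<length : ∀ {n ys y} (f : Box → Box) → Injective _≡_ _≡_ f → HasCard P n → Unique ys →
    (∀ {r} → P r → f r ∈ ys) → y ∈ ys → (∀ {r} → P r → f r ≢ y) → n < length ys
  HasCard⇒<length {ys = ys} {y} f f-inj (zs , !zs , ∈⇔ , refl) !ys f[P]⊆ys y∈ys y∉f[P] =
    subst (_< length ys) (length-map f zs) (Unique-⊆⇒length< (map⁺ f-inj !zs) image⊆ys y∈ys y∉image)
    where
    image⊆ys : map f zs ⊆ ys
    image⊆ys r∈ with ∈-map⁻ f r∈
    ... | z , z∈zs , refl = f[P]⊆ys (∈⇔ z .to z∈zs)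
    y∉image : y ∉ map f zs
    y∉image y∈ with ∈-map⁻ f y∈
    ... | z , z∈zs , refl = y∉f[P] (∈⇔ z .to z∈zs) refl

get0-≤-head : ∀ {x xs} → Linked _≥_ (x ∷ xs) → ∀ n → get0 (x ∷ xs) n ≤ x
get0-≤-head _ zero = ≤-refl
get0-≤-head {xs = []} _ (suc n) = z≤n
get0-≤-head {xs = _ ∷ _} (x≥y ∷ sorted) (suc n) = ≤-trans (get0-≤-head sorted n) x≥y

≤-get0⇔<-length-filter : ∀ {xs c} → Linked _≥_ xs → 1 ≤ c →
  ∀ n → c ≤ get0 xs n ⇔ n < length (filter (c ≤?_) xs)
≤-get0⇔<-length-filter {[]} _ 1≤c n = mk⇔ (λ c≤0 → contradiction (≤-trans 1≤c c≤0) λ ()) λ ()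
≤-get0⇔<-length-filter {x ∷ xs} {c} sorted 1≤c n with c ≤? x | n
... | yes c≤x | zero  rewrite filter-accept (c ≤?_) {x} {xs} c≤x = mk⇔ (λ _ → s≤s z≤n) (λ _ → c≤x)
... | yes c≤x | suc n rewrite filter-accept (c ≤?_) {x} {xs} c≤x = mk⇔ (s≤s ∘ IH .to) (IH .from ∘ s≤s⁻¹)
  where
  IH : c ≤ get0 xs n ⇔ n < length (filter (c ≤?_) xs)
  IH = ≤-get0⇔<-length-filter (Linked.tail sorted) 1≤c n
... | no c≰x  | n     rewrite filter-reject (c ≤?_) {x} {xs} c≰x = mk⇔
  (λ c≤xₙ → ⊥-elim (c≰x (≤-trans c≤xₙ (get0-≤-head sorted n))))
  (λ n<len → ⊥-elim (c≰x (≤-trans (IH .from n<len) (get0-≤-head sorted (suc n)))))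
  where
  IH : c ≤ get0 xs n ⇔ n < length (filter (c ≤?_) xs)
  IH = ≤-get0⇔<-length-filter (Linked.tail sorted) 1≤c n

≤-row⇔≤-col : ∀ lam {i j} → 1 ≤ i → 1 ≤ j → j ≤ row lam i ⇔ i ≤ col lam j
≤-row⇔≤-col lam {suc i} _ 1≤j = ≤-get0⇔<-length-filter (decr lam) 1≤j i

∈ᵧ-up-closed : ∀ lam {i i′ j} → 1 ≤ i → i ≤ i′ → (i′ , j) ∈ᵧ lam → (i , j) ∈ᵧ lam
∈ᵧ-up-closed lam 1≤i i≤i′ (1≤i′ , 1≤j , j≤λᵢ′) =
  1≤i , 1≤j , ≤-row⇔≤-col lam 1≤i 1≤j .from (≤-trans i≤i′ (≤-row⇔≤-col lam 1≤i′ 1≤j .to j≤λᵢ′))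

_∈ᵧ?_ : ∀ r lam → Dec (r ∈ᵧ lam)
(i , j) ∈ᵧ? lam = 1 ≤? i ×-dec 1 ≤? j ×-dec j ≤? row lam i

≤-/⇔*≤ : ∀ {w m d} .{{_ : NonZero d}} → w ≤ m / d ⇔ w * d ≤ m
≤-/⇔*≤ {w} {m} {d} = mk⇔
  (λ w≤m/d → ≤-trans (*-monoˡ-≤ d w≤m/d) (m/n*n≤m m d))
  (λ wd≤m → subst (_≤ m / d) (m*n/n≡m w d) (/-monoˡ-≤ d wd≤m))

module LadderThroughGap
  {a b d : ℕ} (1≤a : 1 ≤ a) (1≤d : 1 ≤ d) (b≡a+d : b ≡ a + d) (lam : Partition)
  (Cr-up-closed : ∀ i j → InCr a b lam (i , j) → 2 ≤ i → InCr a b lam (i ∸ 1 , j))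
  (no-hook : ∀ i j t → (i , j) ∈ᵧ lam → 1 ≤ t →
    ¬ (hook lam i j ≡ t * b × leg lam i j ≡ t * a))
  (s : ℕ) (1≤s : 1 ≤ s)
  where

  instance
    a≢0 : NonZero a
    a≢0 = >-nonZero 1≤a
    d≢0 : NonZero d
    d≢0 = >-nonZero 1≤d

  g m S : ℕ
  g = row lam (s * a)
  m = g + s * d
  S = m / d

  column : ℕ → ℕ
  column w = suc (m ∸ w * d)

  pt : ℕ → ℕ → Box
  pt x w = (x + w * a , column w)

  pt-injective : ∀ x → Injective _≡_ _≡_ (pt x)
  pt-injective x {v} {w} eq = *-cancelʳ-≡ v w a (+-cancelˡ-≡ x _ _ (cong proj₁ eq))

  column-+ : ∀ {w} → w ≤ S → column w + w * d ≡ suc m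
  column-+ w≤S = cong suc (m∸n+n≡m (≤-/⇔*≤ .to w≤S))

  on-ladder : ∀ {j w} → 1 ≤ j → j + w * d ≡ suc m → w ≤ S × j ≡ column w
  on-ladder {j} {w} 1≤j j+wd≡ = ≤-/⇔*≤ .from wd≤m , (begin
    j                 ≡⟨ m+n∸n≡m j (w * d) ⟨
    j + w * d ∸ w * d ≡⟨ cong (_∸ w * d) j+wd≡ ⟩
    suc m ∸ w * d     ≡⟨ +-∸-assoc 1 wd≤m ⟩
    column w          ∎)
    where
    open ≡-Reasoning
    wd≤m : w * d ≤ m
    wd≤m = s≤s⁻¹ (subst (suc (w * d) ≤_) j+wd≡ (+-monoˡ-≤ (w * d) 1≤j))

  InLadder-pt⇔ : ∀ {x u r} → x ≤ 1 → u ≤ S →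
    InLadder a b (x + u * a) (column u) r ⇔ (Σ ℕ λ w → w ≤ S × 1 ≤ x + w * a × r ≡ pt x w)
  InLadder-pt⇔ {x} {u} {i , j} x≤1 u≤S = mk⇔ ⇒ ⇐
    where
    Onℓ OnPts : Set
    Onℓ = InLadder a b (x + u * a) (column u) (i , j)
    OnPts = Σ ℕ λ w → w ≤ S × 1 ≤ x + w * a × (i , j) ≡ pt x w
    rebase : Onℓ ⇔ InLadder a b x (suc m) (i , j)
    rebase = subst (λ Y → Onℓ ⇔ InLadder a b x Y (i , j))
      (column-+ u≤S) (InLadder-shift b≡a+d x u (column u) (i , j))
    ⇒ : Onℓ → OnPts
    ⇒ on with InLadder⇔ℕ b≡a+d 1≤a x≤1 .to (rebase .to on)
    ... | 1≤i , 1≤j , w , refl , j+wd≡ with on-ladder {w = w} 1≤j j+wd≡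
    ...   | w≤S , refl = w , w≤S , 1≤i , refl
    ⇐ : OnPts → Onℓ
    ⇐ (w , w≤S , 1≤i , refl) =
      rebase .from (InLadder⇔ℕ b≡a+d 1≤a x≤1 .from (1≤i , s≤s z≤n , w , refl , column-+ w≤S))

  column-s : column s ≡ suc g
  column-s = cong suc (m+n∸n≡m g (s * d))

  s≤S : s ≤ S
  s≤S = ≤-/⇔*≤ .from (m≤n+m (s * d) g)

  pt0-s∉ : ¬ pt 0 s ∈ᵧ lam
  pt0-s∉ (_ , _ , c≤g) = <-irrefl refl (subst (_≤ g) column-s c≤g)

  pt1-s∉ : ¬ pt 1 s ∈ᵧ lam
  pt1-s∉ pt1∈ = pt0-s∉ (∈ᵧ-up-closed lam (≤-trans 1≤s (m≤m*n s a)) (n≤1+n (s * a)) pt1∈)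

  hook-at-gap : ∀ {w} → s < w → w ≤ S → pt 0 w ∈ᵧ lam → ¬ pt 1 w ∈ᵧ lam →
    (s * a , column w) ∈ᵧ lam ×
    hook lam (s * a) (column w) ≡ (w ∸ s) * b × leg lam (s * a) (column w) ≡ (w ∸ s) * a
  hook-at-gap {w} s<w w≤S (1≤wa , 1≤c , c≤λ) pt1∉ = (≤-trans 1≤s (m≤m*n s a) , 1≤c , c≤g) , hook≡ , leg≡
    where
    open ≡-Reasoning
    t c : ℕ
    t = w ∸ s
    c = column w
    col≡ : col lam c ≡ w * a
    col≡ = ≤-antisym
      (≮⇒≥ λ wa<col → pt1∉ (s≤s z≤n , 1≤c , ≤-row⇔≤-col lam (s≤s z≤n) 1≤c .from wa<col))
      (≤-row⇔≤-col lam 1≤wa 1≤c .to c≤λ)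
    c+td≡ : c + t * d ≡ suc g
    c+td≡ = +-cancelʳ-≡ (s * d) _ _ (begin
      c + t * d + s * d   ≡⟨ +-assoc c (t * d) (s * d) ⟩
      c + (t * d + s * d) ≡⟨ cong (c +_) (*-distribʳ-+ d t s) ⟨
      c + (t + s) * d     ≡⟨ cong (λ v → c + v * d) (m∸n+n≡m (<⇒≤ s<w)) ⟩
      c + w * d           ≡⟨ column-+ w≤S ⟩
      suc m               ∎)
    c≤g : c ≤ g
    c≤g = s≤s⁻¹ (subst (suc c ≤_) c+td≡ (m<m+n c (*-mono-≤ (m<n⇒0<n∸m s<w) 1≤d)))
    leg≡ : leg lam (s * a) c ≡ t * a
    leg≡ = trans (cong (_∸ s * a) col≡) (sym (*-distribʳ-∸ a w s))
    hook≡ : hook lam (s * a) c ≡ t * b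
    hook≡ = begin
      1 + (g ∸ c) + leg lam (s * a) c ≡⟨ cong₂ _+_ (sym (+-∸-assoc 1 c≤g)) leg≡ ⟩
      suc g ∸ c + t * a               ≡⟨ cong (λ v → v ∸ c + t * a) c+td≡ ⟨
      c + t * d ∸ c + t * a           ≡⟨ cong (_+ t * a) (m+n∸m≡n c (t * d)) ⟩
      t * d + t * a                   ≡⟨ +-comm (t * d) (t * a) ⟩
      t * a + t * d                   ≡⟨ *-distribˡ-+ t a d ⟨
      t * (a + d)                     ≡⟨ cong (t *_) b≡a+d ⟨
      t * b                           ∎

  module _ (above-in : ∀ w → w < s → pt 1 w ∈ᵧ lam) where

    pt0⇒pt1 : ∀ {w} → w ≤ S → pt 0 w ∈ᵧ lam → pt 1 w ∈ᵧ lam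
    pt0⇒pt1 {w} w≤S pt0∈ with pt 1 w ∈ᵧ? lam | <-cmp w s
    ... | yes pt1∈ | _            = pt1∈
    ... | no _     | tri< w<s _ _ = above-in w w<s
    ... | no _     | tri≈ _ refl _ = contradiction pt0∈ pt0-s∉
    ... | no pt1∉  | tri> _ _ s<w with hook-at-gap s<w w≤S pt0∈ pt1∉
    ...   | box , hook≡ , leg≡ = contradiction (hook≡ , leg≡) (no-hook _ _ (w ∸ s) box (m<n⇒0<n∸m s<w))

    E T : List ℕ
    E = filter (λ w → pt 1 w ∈ᵧ? lam) (upTo (suc S))

    ∈E⇔ : ∀ {w} → w ∈ E ⇔ (w ≤ S × pt 1 w ∈ᵧ lam)
    ∈E⇔ = mk⇔
      (λ w∈E → let w∈ , pt1∈ = ∈-filter⁻ (λ w → pt 1 w ∈ᵧ? lam) w∈E in s≤s⁻¹ (∈-upTo⁻ w∈) , pt1∈)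
      (λ (w≤S , pt1∈) → ∈-filter⁺ (λ w → pt 1 w ∈ᵧ? lam) (∈-upTo⁺ (s≤s w≤S)) pt1∈)

    !E : Unique E
    !E = filter⁺ (λ w → pt 1 w ∈ᵧ? lam) (upTo⁺ (suc S))

    K u : ℕ
    K = length E

    0∈E : 0 ∈ E
    0∈E = ∈E⇔ .from (z≤n , above-in 0 1≤s)

    K≤S : K ≤ S
    K≤S = s≤s⁻¹ (subst (K <_) (length-applyUpTo (λ w → w) (suc S))
      (Unique-⊆⇒length< !E (λ w∈E → ∈-upTo⁺ (s≤s (proj₁ (∈E⇔ .to w∈E)))) (∈-upTo⁺ (s≤s s≤S))
        (λ s∈E → pt1-s∉ (proj₂ (∈E⇔ .to s∈E)))))

    u = suc S ∸ K

    u+K≡ : u + K ≡ suc S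
    u+K≡ = m∸n+n≡m (≤-trans K≤S (n≤1+n S))

    1≤u : 1 ≤ u
    1≤u = m<n⇒0<n∸m (s≤s K≤S)

    u≤S : u ≤ S
    u≤S = ∸-monoʳ-≤ (suc S) (∈-length 0∈E)

    T = applyUpTo (u +_) K

    ∈T⇔ : ∀ {w} → w ∈ T ⇔ (u ≤ w × w ≤ S)
    ∈T⇔ {w} = mk⇔ ⇒ ⇐
      where
      ⇒ : w ∈ T → u ≤ w × w ≤ S
      ⇒ w∈T with ∈-applyUpTo⁻ (u +_) w∈T
      ... | v , v<K , refl = m≤m+n u v , s≤s⁻¹ (subst (u + v <_) u+K≡ (+-monoʳ-< u v<K))
      ⇐ : u ≤ w × w ≤ S → w ∈ T
      ⇐ (u≤w , w≤S) = subst (_∈ T) (m+[n∸m]≡n u≤w)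
        (∈-applyUpTo⁺ (u +_) (+-cancelˡ-< u _ _ (subst (_< u + K) (sym (m+[n∸m]≡n u≤w)) (subst (w <_) (sym u+K≡) (s≤s w≤S)))))

    !T : Unique T
    !T = applyUpTo⁺₁ (u +_) K (λ v<w _ → <⇒≢ (+-monoʳ-< u v<w))

    length-T : length T ≡ K
    length-T = length-applyUpTo (u +_) K

    pt1-u∈Cr : InCr a b lam (pt 1 u)
    pt1-u∈Cr = s≤s z≤n , s≤s z≤n , K , K ,
      HasCard-map (pt 1) (pt-injective 1) !E (λ _ → mk⇔ onℓ∩λ⇒ onℓ∩λ⇐) ,
      subst (HasCard _) length-T (HasCard-map (pt 1) (pt-injective 1) !T (λ _ → mk⇔ tail⇒ tail⇐)) ,
      ≤-refl
      where
      onℓ∩λ⇒ : ∀ {r} → r ∈ map (pt 1) E → r ∈ᵧ lam × InLadder a b (1 + u * a) (column u) r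
      onℓ∩λ⇒ r∈ with ∈-map⁻ (pt 1) r∈
      ... | w , w∈E , refl = let w≤S , pt1∈ = ∈E⇔ .to w∈E in
        pt1∈ , InLadder-pt⇔ (s≤s z≤n) u≤S .from (w , w≤S , s≤s z≤n , refl)
      onℓ∩λ⇐ : ∀ {r} → r ∈ᵧ lam × InLadder a b (1 + u * a) (column u) r → r ∈ map (pt 1) E
      onℓ∩λ⇐ (r∈ , onℓ) with InLadder-pt⇔ (s≤s z≤n) u≤S .to onℓ
      ... | w , w≤S , _ , refl = ∈-map⁺ (pt 1) (∈E⇔ .from (w≤S , r∈))
      tail⇒ : ∀ {r} → r ∈ map (pt 1) T → InLadder a b (1 + u * a) (column u) r × 1 + u * a ≤ proj₁ r
      tail⇒ r∈ with ∈-map⁻ (pt 1) r∈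
      ... | w , w∈T , refl = let u≤w , w≤S = ∈T⇔ .to w∈T in
        InLadder-pt⇔ (s≤s z≤n) u≤S .from (w , w≤S , s≤s z≤n , refl) , s≤s (*-monoˡ-≤ a u≤w)
      tail⇐ : ∀ {r} → InLadder a b (1 + u * a) (column u) r × 1 + u * a ≤ proj₁ r → r ∈ map (pt 1) T
      tail⇐ (onℓ , below) with InLadder-pt⇔ (s≤s z≤n) u≤S .to onℓ
      ... | w , w≤S , _ , refl = ∈-map⁺ (pt 1) (∈T⇔ .from (*-cancelʳ-≤ u w a (s≤s⁻¹ below) , w≤S))

    points-above-not-all-in : ⊥
    points-above-not-all-in with Cr-up-closed _ _ pt1-u∈Cr (s≤s (≤-trans 1≤u (m≤m*n u a)))
    ... | _ , _ , k , n , onℓ∩λ , tail , n≤k = <-irrefl refl (begin-strict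
      k                        <⟨ HasCard⇒<length down down-injective onℓ∩λ (map⁺ (pt-injective 1) !E)
                                    down-onℓ∩λ (∈-map⁺ (pt 1) 0∈E) (λ ((1≤i , _) , _) → row-0∉ 1≤i) ⟩
      length (map (pt 1) E)    ≡⟨ length-map (pt 1) E ⟩
      K                        ≡⟨ length-T ⟨
      length T                 ≡⟨ length-map (pt 0) T ⟨
      length (map (pt 0) T)    ≤⟨ HasCard⇒length≤ tail (map⁺ (pt-injective 0) !T) tail⊆ ⟩
      n                        ≤⟨ n≤k ⟩
      k                        ∎)
      where
      open ≤-Reasoning
      down : Box → Box
      down (i , j) = (suc i , j)
      down-injective : Injective _≡_ _≡_ down
      down-injective refl = refl
      row-0∉ : ∀ {r} → 1 ≤ proj₁ r → down r ≢ pt 1 0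
      row-0∉ {i , j} 1≤i eq = contradiction (suc-injective (cong proj₁ eq)) (≢-sym (<⇒≢ 1≤i))
      down-onℓ∩λ : ∀ {r} → r ∈ᵧ lam × InLadder a b (u * a) (column u) r → down r ∈ map (pt 1) E
      down-onℓ∩λ (r∈ , onℓ) with InLadder-pt⇔ z≤n u≤S .to onℓ
      ... | w , w≤S , _ , refl = ∈-map⁺ (pt 1) (∈E⇔ .from (w≤S , pt0⇒pt1 w≤S r∈))
      tail⊆ : ∀ {r} → r ∈ map (pt 0) T → InLadder a b (u * a) (column u) r × u * a ≤ proj₁ r
      tail⊆ r∈ with ∈-map⁻ (pt 0) r∈
      ... | w , w∈T , refl = let u≤w , w≤S = ∈T⇔ .to w∈T in
        InLadder-pt⇔ z≤n u≤S .from (w , w≤S , ≤-trans 1≤u (≤-trans u≤w (m≤m*n w a)) , refl) ,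
        *-monoˡ-≤ a u≤w

ladder-left-of-gap-in : ∀ {a b d lam y s j g} → 1 ≤ a → b ≡ a + d → 1 ≤ j → j + s * d ≡ y → g < j →
  (∀ i′ j′ → InLadder a b 1 y (i′ , j′) → ¬ ((i′ , j′) ∈ᵧ lam) → 1 + s * a ≤ i′) →
  ∀ w → w < s → (1 + w * a , suc (g + s * d ∸ w * d)) ∈ᵧ lam
ladder-left-of-gap-in {a} {b} {d} {lam} {y} {s} {j} {g} 1≤a b≡a+d 1≤j j+sd≡y g<j northernmost w w<s
  with (1 + w * a , j + (s ∸ w) * d) ∈ᵧ? lam
... | yes (_ , _ , j′≤λ) = s≤s z≤n , s≤s z≤n , ≤-trans (≤-reflexive column≡) (≤-trans (+-monoˡ-≤ ((s ∸ w) * d) g<j) j′≤λ)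
  where
  column≡ : suc (g + s * d ∸ w * d) ≡ suc g + (s ∸ w) * d
  column≡ = cong suc (trans (+-∸-assoc g (*-monoˡ-≤ d (<⇒≤ w<s))) (cong (g +_) (sym (*-distribʳ-∸ d s w))))
... | no ∉λ = contradiction (*-cancelʳ-≤ s w a {{>-nonZero 1≤a}} (s≤s⁻¹ (northernmost _ _ onℓ ∉λ))) (<⇒≱ w<s)
  where
  j′+wd≡y : j + (s ∸ w) * d + w * d ≡ y
  j′+wd≡y = begin
    j + (s ∸ w) * d + w * d   ≡⟨ +-assoc j _ _ ⟩
    j + ((s ∸ w) * d + w * d) ≡⟨ cong (j +_) (*-distribʳ-+ d (s ∸ w) w) ⟨
    j + (s ∸ w + w) * d       ≡⟨ cong (λ v → j + v * d) (m∸n+n≡m (<⇒≤ w<s)) ⟩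
    j + s * d                 ≡⟨ j+sd≡y ⟩
    y                         ∎
    where open ≡-Reasoning
  onℓ : InLadder a b 1 y (1 + w * a , j + (s ∸ w) * d)
  onℓ = InLadder⇔ℕ b≡a+d 1≤a ≤-refl .from (s≤s z≤n , ≤-trans 1≤j (m≤m+n j _) , w , refl , j′+wd≡y)

lemma3p3 : (a b : ℕ) → 1 ≤ a → a < b → (lam : Partition) →
    IsPartitionSet (InCr a b lam) →
    (∀ i j t → (i , j) ∈ᵧ lam → 1 ≤ t →
      ¬ (hook lam i j ≡ t * b × leg lam i j ≡ t * a)) →
    ∀ y → 1 ≤ y → y ≤ row lam 1 →
    ∀ i j → InLadder a b 1 y (i , j) → ¬ ((i , j) ∈ᵧ lam) →
    (∀ i′ j′ → InLadder a b 1 y (i′ , j′) → ¬ ((i′ , j′) ∈ᵧ lam) → i ≤ i′) →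
    (i ∸ 1 , j) ∈ᵧ lam
lemma3p3 a b 1≤a a<b lam (_ , _ , Cr-up-closed , _) no-hook y _ y≤λ₁ i j onℓ ∉λ northernmost
  with b ∸ a | m<n⇒0<n∸m a<b | sym (m+[n∸m]≡n (<⇒≤ a<b))
... | d | 1≤d | b≡a+d with InLadder⇔ℕ b≡a+d 1≤a ≤-refl .to onℓ
...   | _ , 1≤j , zero , refl , j+0≡y =
  contradiction (s≤s z≤n , 1≤j , subst (_≤ row lam 1) (trans (sym j+0≡y) (+-identityʳ j)) y≤λ₁) ∉λ
...   | _ , 1≤j , s@(suc _) , refl , j+sd≡y with j ≤? row lam (s * a)
...     | yes j≤λ = ≤-trans (s≤s z≤n) (m≤m*n s a {{>-nonZero 1≤a}}) , 1≤j , j≤λ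
...     | no j≰λ = ⊥-elim (LadderThroughGap.points-above-not-all-in 1≤a 1≤d b≡a+d lam Cr-up-closed no-hook s (s≤s z≤n)
                     (ladder-left-of-gap-in {lam = lam} 1≤a b≡a+d 1≤j j+sd≡y (≰⇒> j≰λ) northernmost))
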